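{- Let $A=(a_1,\dots,a_k)$ be a pinwheel packing instance with $a_1\le a_2\le\dots\le a_k$ and $(a_1,a_2,a_3,a_4)=(3,6,6,8)$. If $\sum_{i=1}^k\frac{1}{a_i}>1-\frac{1}{96}$, then $A$ is unschedulable.
   Context: A pinwheel packing instance is a finite list $(a_1,\dots,a_k)$ of positive integers. A schedule $f:\mathbb{N}\to\{1,\dots,k\}$ assigns each day to one job. It is valid if for every $i$, every block of $a_i$ consecutive days contains at least one day assigned to job $i$. The instance is schedulable if a valid schedule exists. -}

module Defs where

open import Data.Nat using (ℕ; zero; suc; _+_; _≤_; _<_)
open import Data.Fin using (Fin)
open import Data.List using (List; length; lookup; map; foldr)
open import Data.Integer using (+_)
open import Data.Rational using (ℚ; 0ℚ; _/_) renaming (_+_ to _+ℚ_)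
open import Data.Product using (Σ; ∃; _×_)
open import Relation.Binary.PropositionalEquality using (_≡_)
open import Relation.Nullary using (¬_)

-- A pinwheel packing instance: a list (a_1,...,a_k) of natural numbers
-- (positivity is imposed separately).  Jobs are indexed by Fin k.

Schedule : List ℕ → Set
Schedule A = ℕ → Fin (length A)

Valid : (A : List ℕ) → Schedule A → Set
Valid A f = ∀ (i : Fin (length A)) (t : ℕ) →
  ∃ λ d → t ≤ d × d < t + lookup A i × f d ≡ i

Schedulable : List ℕ → Set
Schedulable A = Σ (Schedule A) (Valid A)

-- 1/a as a rational (the value at 0 is irrelevant: instances are positive).
recip : ℕ → ℚ
recip zero = 0ℚ
recip (suc n) = + 1 / suc n

density : List ℕ → ℚ
density A = foldr _+ℚ_ 0ℚ (map recip A)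

{-# OPTIONS --safe #-}
module Submission where

-- Record on each day t of a valid schedule the waiting times until the next days of the four jobs
-- with periods 3, 6, 6, 8.  The state on day t is determined by the state on day t + 1 and the job
-- done on day t, and there are only 3·6·6·8 admissible states.  An explicit potential Φ ≤ 49 on
-- them satisfies  Φ(state on t + 1) + 16·[day t is free] ≤ Φ(state on t) + 3,  so n consecutive
-- days contain at most (49 + 3n)/16 days not spent on the first four jobs.  When n is a multiple
-- of every other period a, those jobs need at least n/a days each; letting n grow, their densities
-- sum to at most 3/16, and the total density is at most 1/3 + 1/6 + 1/6 + 1/8 + 3/16 = 1 - 1/48.

open import Defs
open import Data.Bool using (if_then_else_)
open import Data.Fin using (Fin; zero; suc; _↑ˡ_; _↑ʳ_; splitAt)
open import Data.Fin.Patterns using (0F; 1F; 2F; 3F)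
open import Data.Fin.Properties using (_≟_; all?; splitAt-↑ˡ)
open import Data.Integer using (+_; +≤+)
import Data.Integer as ℤ
import Data.Integer.Properties as ℤ
open import Data.List using (List; []; _∷_; length; lookup; drop; head)
open import Data.List.Relation.Unary.All as All using (All; []; _∷_)
open import Data.List.Relation.Unary.Linked using (Linked)
open import Data.Maybe using (Maybe; just; nothing; fromMaybe)
open import Data.Maybe.Properties using (≡-dec)
open import Data.Nat using (ℕ; zero; suc; _+_; _*_; _≤_; _<_; s≤s; z≤n; NonZero; >-nonZero)
open import Data.Nat.ListAction using (product)
open import Data.Nat.ListAction.Properties using (product≢0)
open import Data.Nat.Properties
  using ( +-*-semiring; _≤?_; _<?_; allUpTo?; module ≤-Reasoning
        ; +-assoc; +-suc; +-identityʳ; *-assoc; *-comm; *-suc; *-zeroʳ; *-identityˡ; *-distribˡ-+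
        ; ≤-reflexive; ≤-pred; n≤1+n; n<1+n; ≮⇒≥; <⇒≱; m≤n⇒m<n∨m≡n; m+n≤o⇒n≤o; m*n≢0
        ; +-mono-≤; +-monoˡ-≤; +-monoˡ-<; *-monoˡ-≤; *-monoʳ-≤ )
open import Data.Nat.Tactic.RingSolver using (solve-∀)
open import Algebra.Properties.Semiring.Sum +-*-semiring
  using (sum; sum-syntax; ∑-distrib-+; *-distribˡ-sum; *-distribʳ-sum; sum-replicate-zero)
open import Data.Product using (∃; _×_; _,_)
open import Data.Rational using (_/_; toℚᵘ)
  renaming (_<_ to _<ℚ_; _≤_ to _≤ℚ_; _-_ to _-ℚ_; _+_ to _+ℚ_)
import Data.Rational.Properties as ℚ
open import Data.Rational.Unnormalised using (mkℚᵘ; *≤*)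
import Data.Rational.Unnormalised as ℚᵘ
import Data.Rational.Unnormalised.Properties as ℚᵘ
open import Data.Sum using (_⊎_; inj₁; inj₂; [_,_]′)
open import Data.Vec.Functional using (Vector)
open import Function using (_∘_; const)
open import Relation.Binary.Definitions using (DecidableEquality)
open import Relation.Binary.PropositionalEquality
  using (_≡_; refl; sym; trans; cong; cong₂; subst; subst₂; module ≡-Reasoning)
open import Relation.Nullary using (¬_; Dec; yes; no; does; contradiction)
open import Relation.Nullary.Decidable using (map′; from-yes; _×-dec_; _→-dec_)
open import Relation.Unary using (Decidable)

sum-mono-≤ : ∀ {n} {u v : Vector ℕ n} → (∀ i → u i ≤ v i) → sum u ≤ sum v
sum-mono-≤ {zero}  u≤v = z≤n
sum-mono-≤ {suc n} u≤v = +-mono-≤ (u≤v zero) (sum-mono-≤ (u≤v ∘ suc))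

≤-if-linearly-bounded : ∀ {a b c} → (∀ n → a * n ≤ b + c * n) → a ≤ c
≤-if-linearly-bounded {a} {b} {c} bound with c <? a
... | no  c≮a = ≮⇒≥ c≮a
... | yes c<a = contradiction (bound (suc b)) (<⇒≱ (begin-strict
  b + c * suc b  <⟨ +-monoˡ-< (c * suc b) (n<1+n b) ⟩
  suc c * suc b  ≤⟨ *-monoˡ-≤ (suc b) c<a ⟩
  a * suc b      ∎))
  where open ≤-Reasoning

indicator : ∀ {A : Set} → Dec A → ℕ
indicator a? = if does a? then 1 else 0

∑-indicator-≟ : ∀ {k} (y : Fin k) → ∑[ m < k ] indicator (y ≟ m) ≡ 1
∑-indicator-≟ {suc k} zero    = cong suc (sum-replicate-zero k)
∑-indicator-≟ {suc k} (suc y) = ∑-indicator-≟ y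

module _ {P : ℕ → Set} (P? : Decidable P) where

  OccursIn : ℕ → ℕ → Set
  OccursIn t n = ∃ λ d → t ≤ d × d < t + n × P d

  count : ℕ → ℕ → ℕ
  count t zero    = 0
  count t (suc n) = indicator (P? t) + count (suc t) n

  wait : ℕ → ℕ → ℕ
  wait t zero    = 0
  wait t (suc h) = if does (P? t) then 0 else suc (wait (suc t) h)

  ¬OccursIn-0 : ∀ {t} → ¬ OccursIn t 0
  ¬OccursIn-0 {t} (d , t≤d , d<t+0 , _) = <⇒≱ (subst (d <_) (+-identityʳ t) d<t+0) t≤d

  OccursIn-suc : ∀ {t n} → OccursIn t (suc n) → P t ⊎ OccursIn (suc t) n
  OccursIn-suc {t} {n} (d , t≤d , d<t+1+n , Pd) with m≤n⇒m<n∨m≡n t≤d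
  ... | inj₁ t<d  = inj₂ (d , t<d , subst (d <_) (+-suc t n) d<t+1+n , Pd)
  ... | inj₂ refl = inj₁ Pd

  count-+ : ∀ t m n → count t (m + n) ≡ count t m + count (t + m) n
  count-+ t zero    n = cong (λ u → count u n) (sym (+-identityʳ t))
  count-+ t (suc m) n = begin
    i + count (suc t) (m + n)
      ≡⟨ cong (_+_ i) (count-+ (suc t) m n) ⟩
    i + (count (suc t) m + count (suc t + m) n)
      ≡⟨ sym (+-assoc i _ _) ⟩
    i + count (suc t) m + count (suc t + m) n
      ≡⟨ cong (λ u → i + count (suc t) m + count u n) (sym (+-suc t m)) ⟩
    i + count (suc t) m + count (t + suc m) n ∎
    where
    open ≡-Reasoning
    i = indicator (P? t)

  count-pos : ∀ {t n} → OccursIn t n → 0 < count t n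
  count-pos {n = zero} occ = contradiction occ ¬OccursIn-0
  count-pos {t} {suc n} occ with P? t | OccursIn-suc occ
  ... | yes _  | _         = s≤s z≤n
  ... | no ¬Pt | inj₁ Pt   = contradiction Pt ¬Pt
  ... | no _   | inj₂ occ′ = count-pos occ′

  count-≥-blocks : ∀ {a} → (∀ t → OccursIn t a) → ∀ t q → q ≤ count t (q * a)
  count-≥-blocks     occurs t zero    = z≤n
  count-≥-blocks {a} occurs t (suc q) rewrite count-+ t a (q * a) =
    +-mono-≤ (count-pos (occurs t)) (count-≥-blocks occurs (t + a) q)

  count-potential-bound : (Φ : ℕ → ℕ) {c r : ℕ} →
    (∀ t → Φ (suc t) + c * indicator (P? t) ≤ Φ t + r) →
    ∀ t n → Φ (t + n) + c * count t n ≤ Φ t + r * n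
  count-potential-bound Φ {c} {r} step t zero = ≤-reflexive (begin
    Φ (t + 0) + c * 0  ≡⟨ cong₂ (λ u v → Φ u + v) (+-identityʳ t) (*-zeroʳ c) ⟩
    Φ t + 0            ≡⟨ cong (_+_ (Φ t)) (sym (*-zeroʳ r)) ⟩
    Φ t + r * 0        ∎)
    where open ≡-Reasoning
  count-potential-bound Φ {c} {r} step t (suc n) = begin
    Φ (t + suc n) + c * (i + count (suc t) n)
      ≡⟨ cong₂ (λ u v → Φ u + v) (+-suc t n) (*-distribˡ-+ c i _) ⟩
    Φ (suc t + n) + (c * i + c * count (suc t) n)
      ≡⟨ rearrange (Φ (suc t + n)) (c * i) (c * count (suc t) n) ⟩
    Φ (suc t + n) + c * count (suc t) n + c * i
      ≤⟨ +-monoˡ-≤ (c * i) (count-potential-bound Φ {c} {r} step (suc t) n) ⟩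
    Φ (suc t) + r * n + c * i
      ≡⟨ rearrange′ (Φ (suc t)) (r * n) (c * i) ⟩
    Φ (suc t) + c * i + r * n
      ≤⟨ +-monoˡ-≤ (r * n) (step t) ⟩
    Φ t + r + r * n
      ≡⟨ trans (+-assoc (Φ t) r (r * n)) (cong (_+_ (Φ t)) (sym (*-suc r n))) ⟩
    Φ t + r * suc n ∎
    where
    open ≤-Reasoning
    i = indicator (P? t)
    rearrange : ∀ x y z → x + (y + z) ≡ x + z + y
    rearrange = solve-∀
    rearrange′ : ∀ x y z → x + y + z ≡ x + z + y
    rearrange′ = solve-∀

  wait-< : ∀ {t h} → OccursIn t h → wait t h < h
  wait-< {h = zero} occ = contradiction occ ¬OccursIn-0
  wait-< {t} {suc h} occ with P? t | OccursIn-suc occ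
  ... | yes _  | _         = s≤s z≤n
  ... | no ¬Pt | inj₁ Pt   = contradiction Pt ¬Pt
  ... | no _   | inj₂ occ′ = s≤s (wait-< occ′)

  wait-stable : ∀ {t m n} → wait t m < m → m ≤ n → wait t n ≡ wait t m
  wait-stable {t} {suc m} {suc n} w<m (s≤s m≤n) with P? t
  ... | yes _ = refl
  ... | no  _ = cong suc (wait-stable (≤-pred w<m) m≤n)

  wait-step : ∀ {t h} → wait t h < h →
    wait t h ≡ (if does (P? t) then 0 else suc (wait (suc t) h))
  wait-step {t} {suc h} w<h with P? t
  ... | yes _ = refl
  ... | no  _ = cong suc (sym (wait-stable (≤-pred w<h) (n≤1+n h)))

∑-count-≤ : ∀ {k} {P : Fin k → ℕ → Set} {Q : ℕ → Set}
  (P? : ∀ m → Decidable (P m)) (Q? : Decidable Q) →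
  (∀ d → ∑[ m < k ] indicator (P? m d) ≤ indicator (Q? d)) →
  ∀ t n → ∑[ m < k ] count (P? m) t n ≤ count Q? t n
∑-count-≤ {k} P? Q? one-per-day t zero    = ≤-reflexive (sum-replicate-zero k)
∑-count-≤ {k} P? Q? one-per-day t (suc n) = begin
  ∑[ m < k ] (indicator (P? m t) + count (P? m) (suc t) n)
    ≡⟨ ∑-distrib-+ (λ m → indicator (P? m t)) (λ m → count (P? m) (suc t) n) ⟩
  ∑[ m < k ] indicator (P? m t) + ∑[ m < k ] count (P? m) (suc t) n
    ≤⟨ +-mono-≤ (one-per-day t) (∑-count-≤ P? Q? one-per-day (suc t) n) ⟩
  indicator (Q? t) + count Q? (suc t) n ∎
  where open ≤-Reasoning

recip-toℚᵘ : ∀ a .{{_ : NonZero a}} → toℚᵘ (recip a) ℚᵘ.≃ + 1 ℚᵘ./ a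
recip-toℚᵘ (suc a) = ℚ.toℚᵘ-fromℚᵘ (mkℚᵘ (+ 1) a)

/-+-/ : ∀ a b c d .{{_ : NonZero b}} .{{_ : NonZero d}} →
  (+ a ℚᵘ./ b) ℚᵘ.+ (+ c ℚᵘ./ d) ℚᵘ.≃ (+ (a * d + c * b) ℚᵘ./ (b * d)) {{m*n≢0 b d}}
/-+-/ a (suc b) c (suc d) = ℚᵘ.≃-reflexive (cong (λ n → mkℚᵘ n (d + b * suc d)) numerator)
  where
  numerator : + a ℤ.* + suc d ℤ.+ + c ℤ.* + suc b ≡ + (a * suc d + c * suc b)
  numerator = sym (trans (ℤ.pos-+ (a * suc d) (c * suc b))
                         (cong₂ ℤ._+_ (ℤ.pos-* a (suc d)) (ℤ.pos-* c (suc b))))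

/-≤-/ : ∀ a b c d .{{_ : NonZero b}} .{{_ : NonZero d}} →
  a * d ≤ c * b → + a ℚᵘ./ b ℚᵘ.≤ + c ℚᵘ./ d
/-≤-/ a (suc b) c (suc d) ad≤cb =
  *≤* (subst₂ ℤ._≤_ (ℤ.pos-* a (suc d)) (ℤ.pos-* c (suc b)) (+≤+ ad≤cb))

cofactors : (xs : List ℕ) → Vector ℕ (length xs)
cofactors (x ∷ xs) zero    = product xs
cofactors (x ∷ xs) (suc m) = x * cofactors xs m

cofactors-* : ∀ xs m → cofactors xs m * lookup xs m ≡ product xs
cofactors-* (x ∷ xs) zero    = *-comm (product xs) x
cofactors-* (x ∷ xs) (suc m) = trans (*-assoc x _ _) (cong (x *_) (cofactors-* xs m))

density-fraction : ∀ {xs} (nz : All NonZero xs) →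
  toℚᵘ (density xs) ℚᵘ.≃ (+ sum (cofactors xs) ℚᵘ./ product xs) {{product≢0 nz}}
density-fraction [] = ℚᵘ.≃-refl
density-fraction {x ∷ xs} (nzx ∷ nz) = begin
  toℚᵘ (density (x ∷ xs))                ≈⟨ ℚ.toℚᵘ-homo-+ (recip x) (density xs) ⟩
  toℚᵘ (recip x) ℚᵘ.+ toℚᵘ (density xs)  ≈⟨ ℚᵘ.+-cong (recip-toℚᵘ x) (density-fraction nz) ⟩
  (+ 1 ℚᵘ./ x) ℚᵘ.+ (+ C ℚᵘ./ P)         ≈⟨ /-+-/ 1 x C P ⟩
  + (1 * P + C * x) ℚᵘ./ (x * P)         ≡⟨ cong (λ n → + n ℚᵘ./ (x * P)) numerator ⟩
  + sum (cofactors (x ∷ xs)) ℚᵘ./ (x * P) ∎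
  where
  open ℚᵘ.≃-Reasoning
  P = product xs
  C = sum (cofactors xs)
  instance
    nzx′ : NonZero x
    nzx′ = nzx
    nzP : NonZero P
    nzP = product≢0 nz
    nzxP : NonZero (x * P)
    nzxP = product≢0 (nzx ∷ nz)
  numerator : 1 * P + C * x ≡ P + ∑[ m < length xs ] (x * cofactors xs m)
  numerator = cong₂ _+_ (*-identityˡ P) (trans (*-comm C x) (*-distribˡ-sum x (cofactors xs)))

heavy : ∀ {k} → Fin (4 + k) → Maybe (Fin 4)
heavy = [ just , const nothing ]′ ∘ splitAt 4

heavy-↑ˡ : ∀ {k} (j : Fin 4) → heavy (j ↑ˡ k) ≡ just j
heavy-↑ˡ {k} j = cong [ just , const nothing ]′ (splitAt-↑ˡ 4 j k)

_≟ₘ_ : DecidableEquality (Maybe (Fin 4))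
_≟ₘ_ = ≡-dec _≟_

∑-free-jobs-≤ : ∀ {k} (x : Fin (4 + k)) →
  ∑[ m < k ] indicator (x ≟ 4 ↑ʳ m) ≤ indicator (heavy x ≟ₘ nothing)
∑-free-jobs-≤ {k} 0F = ≤-reflexive (sum-replicate-zero k)
∑-free-jobs-≤ {k} 1F = ≤-reflexive (sum-replicate-zero k)
∑-free-jobs-≤ {k} 2F = ≤-reflexive (sum-replicate-zero k)
∑-free-jobs-≤ {k} 3F = ≤-reflexive (sum-replicate-zero k)
∑-free-jobs-≤ (suc (suc (suc (suc y)))) = ≤-reflexive (∑-indicator-≟ y)

-- Waiting times until the next days of the jobs with periods 3, 6, 6, 8.
State : Set
State = ℕ × ℕ × ℕ × ℕ

Admissible : State → Set
Admissible (a , b , c , d) = a < 3 × b < 6 × c < 6 × d < 8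

admissible? : ∀ s → Dec (Admissible s)
admissible? (a , b , c , d) = a <? 3 ×-dec b <? 6 ×-dec c <? 6 ×-dec d <? 8

-- The state one day earlier, when that day goes to heavy job x (x = nothing: to a free job).
arrive : Maybe (Fin 4) → State → State
arrive x (a , b , c , d) = renew 0F a , renew 1F b , renew 2F c , renew 3F d
  where
  renew : Fin 4 → ℕ → ℕ
  renew j w = if does (x ≟ₘ just j) then 0 else suc w

-- Φ is a potential for the graph of admissible states with edge weights 16·[free] − 3 (Φ-step
-- below); it certifies that no walk, i.e. no schedule, has more than 3/16 free days in the long
-- run.  The table lists Φ (a , b , c , d) in lexicographic order, one line per (a , b , c).
potentials : List ℕ
potentials =
   0 ∷  0 ∷  0 ∷  0 ∷  0 ∷  0 ∷  0 ∷  0 ∷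
   0 ∷  0 ∷  0 ∷  0 ∷  0 ∷  0 ∷  0 ∷  0 ∷
   0 ∷  0 ∷  0 ∷  0 ∷  0 ∷  0 ∷  0 ∷  0 ∷
   0 ∷  0 ∷  0 ∷  0 ∷  0 ∷  0 ∷  0 ∷  0 ∷
   0 ∷  0 ∷  0 ∷  0 ∷  0 ∷  0 ∷  0 ∷  0 ∷
   0 ∷  0 ∷  0 ∷  0 ∷  0 ∷  0 ∷  0 ∷  0 ∷
   0 ∷  0 ∷  0 ∷  0 ∷  0 ∷  0 ∷  0 ∷  0 ∷
   0 ∷  0 ∷  0 ∷  0 ∷  0 ∷  0 ∷  0 ∷  0 ∷
   0 ∷  0 ∷  0 ∷  0 ∷ 12 ∷ 12 ∷ 14 ∷ 14 ∷
   0 ∷  0 ∷  0 ∷  7 ∷  7 ∷  7 ∷  9 ∷ 11 ∷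
   0 ∷  0 ∷ 10 ∷  7 ∷  7 ∷ 17 ∷ 14 ∷ 19 ∷
   0 ∷  0 ∷ 13 ∷  7 ∷ 15 ∷ 17 ∷ 17 ∷ 19 ∷
   0 ∷  0 ∷  0 ∷  0 ∷  0 ∷  0 ∷  0 ∷  0 ∷
   0 ∷  0 ∷  0 ∷  0 ∷ 12 ∷ 12 ∷ 14 ∷ 14 ∷
   0 ∷  0 ∷ 10 ∷ 10 ∷ 10 ∷ 10 ∷ 10 ∷ 10 ∷
   0 ∷  0 ∷ 10 ∷ 10 ∷ 10 ∷ 10 ∷ 10 ∷ 11 ∷
   0 ∷  8 ∷ 10 ∷ 10 ∷ 10 ∷ 20 ∷ 14 ∷ 22 ∷
   0 ∷ 11 ∷ 10 ∷ 10 ∷ 18 ∷ 17 ∷ 17 ∷ 25 ∷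
   0 ∷  0 ∷  0 ∷  0 ∷  0 ∷  0 ∷  0 ∷  0 ∷
   0 ∷  0 ∷  0 ∷  7 ∷  7 ∷  7 ∷  9 ∷ 11 ∷
   0 ∷  0 ∷ 10 ∷ 10 ∷ 10 ∷ 10 ∷ 10 ∷ 11 ∷
   0 ∷  7 ∷ 10 ∷ 23 ∷ 23 ∷ 23 ∷ 23 ∷ 23 ∷
   0 ∷  8 ∷ 10 ∷ 23 ∷ 23 ∷ 23 ∷ 23 ∷ 23 ∷
   0 ∷  7 ∷ 10 ∷ 23 ∷ 23 ∷ 23 ∷ 23 ∷ 23 ∷
   0 ∷  0 ∷  0 ∷  0 ∷  0 ∷  0 ∷  0 ∷  0 ∷
   0 ∷  0 ∷ 10 ∷  7 ∷  7 ∷ 17 ∷ 14 ∷ 19 ∷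
   0 ∷  8 ∷ 10 ∷ 10 ∷ 10 ∷ 20 ∷ 14 ∷ 22 ∷
   0 ∷  8 ∷ 10 ∷ 23 ∷ 23 ∷ 23 ∷ 23 ∷ 23 ∷
   0 ∷  7 ∷ 10 ∷ 23 ∷ 23 ∷ 23 ∷ 23 ∷ 23 ∷
   0 ∷ 21 ∷ 21 ∷ 23 ∷ 23 ∷ 23 ∷ 23 ∷ 35 ∷
   0 ∷  0 ∷  0 ∷  0 ∷  0 ∷  0 ∷  0 ∷  0 ∷
   0 ∷  0 ∷ 13 ∷  7 ∷ 15 ∷ 17 ∷ 17 ∷ 19 ∷
   0 ∷ 11 ∷ 10 ∷ 10 ∷ 18 ∷ 17 ∷ 17 ∷ 25 ∷
   0 ∷  7 ∷ 10 ∷ 23 ∷ 23 ∷ 23 ∷ 23 ∷ 23 ∷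
   0 ∷ 21 ∷ 21 ∷ 23 ∷ 23 ∷ 23 ∷ 23 ∷ 35 ∷
   0 ∷ 17 ∷ 17 ∷ 23 ∷ 23 ∷ 33 ∷ 33 ∷ 33 ∷
   0 ∷  0 ∷  0 ∷  0 ∷  0 ∷  0 ∷  0 ∷  0 ∷
   0 ∷  0 ∷  0 ∷  0 ∷  0 ∷  0 ∷  0 ∷  0 ∷
   0 ∷  0 ∷  0 ∷ 10 ∷  4 ∷ 12 ∷ 14 ∷ 14 ∷
   0 ∷  0 ∷  8 ∷  7 ∷  7 ∷ 15 ∷ 17 ∷ 14 ∷
   0 ∷  0 ∷  5 ∷  7 ∷ 20 ∷ 20 ∷ 20 ∷ 20 ∷
   0 ∷  0 ∷ 18 ∷ 18 ∷ 20 ∷ 20 ∷ 20 ∷ 20 ∷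
   0 ∷  0 ∷  0 ∷  0 ∷  0 ∷  0 ∷  0 ∷  0 ∷
   0 ∷ 13 ∷ 13 ∷ 13 ∷ 13 ∷ 13 ∷ 13 ∷ 13 ∷
   0 ∷ 13 ∷ 13 ∷ 13 ∷ 13 ∷ 13 ∷ 13 ∷ 13 ∷
   0 ∷ 13 ∷ 13 ∷ 13 ∷ 13 ∷ 13 ∷ 13 ∷ 13 ∷
   0 ∷ 13 ∷ 13 ∷ 13 ∷ 13 ∷ 13 ∷ 13 ∷ 13 ∷
   0 ∷ 13 ∷ 13 ∷ 13 ∷ 13 ∷ 13 ∷ 13 ∷ 13 ∷
   0 ∷  0 ∷  0 ∷ 10 ∷  4 ∷ 12 ∷ 14 ∷ 14 ∷
   0 ∷ 13 ∷ 13 ∷ 13 ∷ 13 ∷ 13 ∷ 13 ∷ 13 ∷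
   0 ∷ 13 ∷ 13 ∷ 13 ∷ 13 ∷ 13 ∷ 13 ∷ 13 ∷
  11 ∷ 13 ∷ 13 ∷ 13 ∷ 13 ∷ 25 ∷ 25 ∷ 27 ∷
   8 ∷ 13 ∷ 13 ∷ 13 ∷ 20 ∷ 20 ∷ 20 ∷ 22 ∷
  16 ∷ 13 ∷ 13 ∷ 23 ∷ 20 ∷ 20 ∷ 30 ∷ 27 ∷
   0 ∷  0 ∷  8 ∷  7 ∷  7 ∷ 15 ∷ 17 ∷ 14 ∷
   0 ∷ 13 ∷ 13 ∷ 13 ∷ 13 ∷ 13 ∷ 13 ∷ 13 ∷
  11 ∷ 13 ∷ 13 ∷ 13 ∷ 13 ∷ 25 ∷ 25 ∷ 27 ∷
   7 ∷ 13 ∷ 13 ∷ 23 ∷ 23 ∷ 23 ∷ 23 ∷ 23 ∷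
   8 ∷ 13 ∷ 13 ∷ 23 ∷ 23 ∷ 23 ∷ 23 ∷ 23 ∷
  19 ∷ 13 ∷ 21 ∷ 23 ∷ 23 ∷ 23 ∷ 33 ∷ 27 ∷
   0 ∷  0 ∷  5 ∷  7 ∷ 20 ∷ 20 ∷ 20 ∷ 20 ∷
   0 ∷ 13 ∷ 13 ∷ 13 ∷ 13 ∷ 13 ∷ 13 ∷ 13 ∷
   8 ∷ 13 ∷ 13 ∷ 13 ∷ 20 ∷ 20 ∷ 20 ∷ 22 ∷
   8 ∷ 13 ∷ 13 ∷ 23 ∷ 23 ∷ 23 ∷ 23 ∷ 23 ∷
  20 ∷ 13 ∷ 20 ∷ 23 ∷ 36 ∷ 36 ∷ 36 ∷ 36 ∷
  20 ∷ 13 ∷ 21 ∷ 23 ∷ 36 ∷ 36 ∷ 36 ∷ 36 ∷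
   0 ∷  0 ∷ 18 ∷ 18 ∷ 20 ∷ 20 ∷ 20 ∷ 20 ∷
   0 ∷ 13 ∷ 13 ∷ 13 ∷ 13 ∷ 13 ∷ 13 ∷ 13 ∷
  16 ∷ 13 ∷ 13 ∷ 23 ∷ 20 ∷ 20 ∷ 30 ∷ 27 ∷
  19 ∷ 13 ∷ 21 ∷ 23 ∷ 23 ∷ 23 ∷ 33 ∷ 27 ∷
  20 ∷ 13 ∷ 21 ∷ 23 ∷ 36 ∷ 36 ∷ 36 ∷ 36 ∷
  20 ∷ 13 ∷ 20 ∷ 23 ∷ 36 ∷ 36 ∷ 36 ∷ 36 ∷
   0 ∷  0 ∷  0 ∷  0 ∷  0 ∷  0 ∷  0 ∷  0 ∷
   0 ∷  0 ∷  0 ∷ 15 ∷ 15 ∷ 17 ∷ 17 ∷ 17 ∷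
   0 ∷  0 ∷ 10 ∷ 10 ∷ 10 ∷ 10 ∷ 10 ∷ 10 ∷
   0 ∷ 13 ∷ 10 ∷ 10 ∷ 20 ∷ 17 ∷ 22 ∷ 27 ∷
   0 ∷ 16 ∷ 10 ∷ 18 ∷ 20 ∷ 20 ∷ 22 ∷ 30 ∷
   0 ∷ 17 ∷ 10 ∷ 18 ∷ 20 ∷ 33 ∷ 33 ∷ 33 ∷
   0 ∷  0 ∷  0 ∷ 15 ∷ 15 ∷ 17 ∷ 17 ∷ 17 ∷
   0 ∷ 13 ∷ 13 ∷ 13 ∷ 13 ∷ 13 ∷ 13 ∷ 13 ∷
   0 ∷ 13 ∷ 13 ∷ 13 ∷ 13 ∷ 13 ∷ 13 ∷ 13 ∷
  11 ∷ 13 ∷ 13 ∷ 13 ∷ 23 ∷ 17 ∷ 25 ∷ 27 ∷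
  14 ∷ 13 ∷ 13 ∷ 21 ∷ 20 ∷ 20 ∷ 28 ∷ 30 ∷
  17 ∷ 13 ∷ 13 ∷ 18 ∷ 20 ∷ 33 ∷ 33 ∷ 33 ∷
   0 ∷  0 ∷ 10 ∷ 10 ∷ 10 ∷ 10 ∷ 10 ∷ 10 ∷
   0 ∷ 13 ∷ 13 ∷ 13 ∷ 13 ∷ 13 ∷ 13 ∷ 13 ∷
  10 ∷ 13 ∷ 26 ∷ 26 ∷ 26 ∷ 26 ∷ 26 ∷ 26 ∷
  10 ∷ 13 ∷ 26 ∷ 26 ∷ 26 ∷ 26 ∷ 26 ∷ 26 ∷
  10 ∷ 13 ∷ 26 ∷ 26 ∷ 26 ∷ 26 ∷ 26 ∷ 26 ∷
  10 ∷ 13 ∷ 26 ∷ 26 ∷ 26 ∷ 26 ∷ 26 ∷ 26 ∷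
   0 ∷ 13 ∷ 10 ∷ 10 ∷ 20 ∷ 17 ∷ 22 ∷ 27 ∷
  11 ∷ 13 ∷ 13 ∷ 13 ∷ 23 ∷ 17 ∷ 25 ∷ 27 ∷
  10 ∷ 13 ∷ 26 ∷ 26 ∷ 26 ∷ 26 ∷ 26 ∷ 26 ∷
  10 ∷ 13 ∷ 26 ∷ 26 ∷ 26 ∷ 26 ∷ 26 ∷ 26 ∷
  24 ∷ 24 ∷ 26 ∷ 26 ∷ 26 ∷ 26 ∷ 38 ∷ 38 ∷
  19 ∷ 21 ∷ 26 ∷ 26 ∷ 26 ∷ 33 ∷ 33 ∷ 33 ∷
   0 ∷ 16 ∷ 10 ∷ 18 ∷ 20 ∷ 20 ∷ 22 ∷ 30 ∷
  14 ∷ 13 ∷ 13 ∷ 21 ∷ 20 ∷ 20 ∷ 28 ∷ 30 ∷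
  10 ∷ 13 ∷ 26 ∷ 26 ∷ 26 ∷ 26 ∷ 26 ∷ 26 ∷
  24 ∷ 24 ∷ 26 ∷ 26 ∷ 26 ∷ 26 ∷ 38 ∷ 38 ∷
  20 ∷ 20 ∷ 26 ∷ 26 ∷ 36 ∷ 36 ∷ 36 ∷ 36 ∷
  20 ∷ 21 ∷ 26 ∷ 26 ∷ 36 ∷ 36 ∷ 36 ∷ 36 ∷
   0 ∷ 17 ∷ 10 ∷ 18 ∷ 20 ∷ 33 ∷ 33 ∷ 33 ∷
  17 ∷ 13 ∷ 13 ∷ 18 ∷ 20 ∷ 33 ∷ 33 ∷ 33 ∷
  10 ∷ 13 ∷ 26 ∷ 26 ∷ 26 ∷ 26 ∷ 26 ∷ 26 ∷
  19 ∷ 21 ∷ 26 ∷ 26 ∷ 26 ∷ 33 ∷ 33 ∷ 33 ∷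
  20 ∷ 21 ∷ 26 ∷ 26 ∷ 36 ∷ 36 ∷ 36 ∷ 36 ∷
  33 ∷ 33 ∷ 26 ∷ 33 ∷ 36 ∷ 49 ∷ 49 ∷ 49 ∷
  []

Φ : State → ℕ
Φ (a , b , c , d) = fromMaybe 0 (head (drop (((a * 6 + b) * 6 + c) * 8 + d) potentials))

∀-admissible? : {P : State → Set} → (∀ s → Dec (P s)) → Dec (∀ s → Admissible s → P s)
∀-admissible? P? =
  map′ (λ h (a , b , c , d) (a<3 , b<6 , c<6 , d<8) → h {a} a<3 {b} b<6 {c} c<6 {d} d<8)
       (λ h {a} a<3 {b} b<6 {c} c<6 {d} d<8 → h (a , b , c , d) (a<3 , b<6 , c<6 , d<8))
       (allUpTo? (λ a → allUpTo? (λ b → allUpTo? (λ c → allUpTo? (λ d →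
         P? (a , b , c , d)) 8) 6) 6) 3)

Φ-≤-49 : ∀ s → Admissible s → Φ s ≤ 49
Φ-≤-49 = from-yes (∀-admissible? λ s → Φ s ≤? 49)

Φ-step : ∀ x s → Admissible s → Admissible (arrive x s) →
  Φ s + 16 * indicator (x ≟ₘ nothing) ≤ Φ (arrive x s) + 3
Φ-step nothing = from-yes (∀-admissible? λ s →
  admissible? (arrive nothing s) →-dec Φ s + 16 ≤? Φ (arrive nothing s) + 3)
Φ-step (just j) s adm = from-yes (∀-admissible? λ s → all? λ j →
  admissible? (arrive (just j) s) →-dec Φ s + 0 ≤? Φ (arrive (just j) s) + 3) s adm j

module _ (rest : List ℕ) (f : Schedule (3 ∷ 6 ∷ 6 ∷ 8 ∷ rest))
         (valid : Valid (3 ∷ 6 ∷ 6 ∷ 8 ∷ rest) f) where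

  private
    k = length rest

  jobDay? : (i : Fin (4 + k)) → Decidable (λ d → f d ≡ i)
  jobDay? i d = f d ≟ i

  heavyDay? : (j : Fin 4) → Decidable (λ d → heavy (f d) ≡ just j)
  heavyDay? j d = heavy (f d) ≟ₘ just j

  freeDay? : Decidable (λ d → heavy (f d) ≡ nothing)
  freeDay? d = heavy (f d) ≟ₘ nothing

  waitFor : Fin 4 → ℕ → ℕ
  waitFor j t = wait (heavyDay? j) t (lookup (3 ∷ 6 ∷ 6 ∷ 8 ∷ rest) (j ↑ˡ k))

  waitFor-< : ∀ j t → waitFor j t < lookup (3 ∷ 6 ∷ 6 ∷ 8 ∷ rest) (j ↑ˡ k)
  waitFor-< j t with valid (j ↑ˡ k) t
  ... | d , t≤d , d<t+a , fd≡j =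
    wait-< (heavyDay? j) (d , t≤d , d<t+a , trans (cong heavy fd≡j) (heavy-↑ˡ j))

  waits : ℕ → State
  waits t = waitFor 0F t , waitFor 1F t , waitFor 2F t , waitFor 3F t

  waits-admissible : ∀ t → Admissible (waits t)
  waits-admissible t = waitFor-< 0F t , waitFor-< 1F t , waitFor-< 2F t , waitFor-< 3F t

  waits-arrive : ∀ t → waits t ≡ arrive (heavy (f t)) (waits (suc t))
  waits-arrive t =
    cong₂ _,_ (renewed 0F) (cong₂ _,_ (renewed 1F) (cong₂ _,_ (renewed 2F) (renewed 3F)))
    where
    renewed : ∀ j → waitFor j t ≡ (if does (heavyDay? j t) then 0 else suc (waitFor j (suc t)))
    renewed j = wait-step (heavyDay? j) (waitFor-< j t)

  potential-step : ∀ t → Φ (waits (suc t)) + 16 * indicator (freeDay? t) ≤ Φ (waits t) + 3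
  potential-step t =
    subst (λ s → Φ (waits (suc t)) + 16 * indicator (freeDay? t) ≤ Φ s + 3)
          (sym (waits-arrive t))
          (Φ-step (heavy (f t)) (waits (suc t)) (waits-admissible (suc t))
                  (subst Admissible (waits-arrive t) (waits-admissible t)))

  free-days-bound : ∀ n → 16 * count freeDay? 0 n ≤ 49 + 3 * n
  free-days-bound n = m+n≤o⇒n≤o (Φ (waits n)) (begin
    Φ (waits n) + 16 * count freeDay? 0 n
      ≤⟨ count-potential-bound freeDay? (Φ ∘ waits) {16} {3} potential-step 0 n ⟩
    Φ (waits 0) + 3 * n
      ≤⟨ +-monoˡ-≤ (3 * n) (Φ-≤-49 (waits 0) (waits-admissible 0)) ⟩
    49 + 3 * n ∎)
    where open ≤-Reasoning

  free-job-days : ∀ m N → cofactors rest m * N ≤ count (jobDay? (4 ↑ʳ m)) 0 (product rest * N)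
  free-job-days m N =
    subst (λ L → cofactors rest m * N ≤ count (jobDay? (4 ↑ʳ m)) 0 L) blocks
      (count-≥-blocks (jobDay? (4 ↑ʳ m)) (valid (4 ↑ʳ m)) 0 (cofactors rest m * N))
    where
    open ≡-Reasoning
    a = lookup rest m
    blocks : cofactors rest m * N * a ≡ product rest * N
    blocks = begin
      cofactors rest m * N * a    ≡⟨ *-assoc (cofactors rest m) N a ⟩
      cofactors rest m * (N * a)  ≡⟨ cong (cofactors rest m *_) (*-comm N a) ⟩
      cofactors rest m * (a * N)  ≡⟨ sym (*-assoc (cofactors rest m) a N) ⟩
      cofactors rest m * a * N    ≡⟨ cong (_* N) (cofactors-* rest m) ⟩
      product rest * N            ∎

  cofactor-sum-bound : 16 * sum (cofactors rest) ≤ 3 * product rest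
  cofactor-sum-bound = ≤-if-linearly-bounded {b = 49} λ N → begin
    16 * sum (cofactors rest) * N
      ≡⟨ *-assoc 16 (sum (cofactors rest)) N ⟩
    16 * (sum (cofactors rest) * N)
      ≡⟨ cong (16 *_) (*-distribʳ-sum N (cofactors rest)) ⟩
    16 * ∑[ m < k ] (cofactors rest m * N)
      ≤⟨ *-monoʳ-≤ 16 (sum-mono-≤ λ m → free-job-days m N) ⟩
    16 * ∑[ m < k ] count (jobDay? (4 ↑ʳ m)) 0 (product rest * N)
      ≤⟨ *-monoʳ-≤ 16 (∑-count-≤ (jobDay? ∘ (4 ↑ʳ_)) freeDay? (∑-free-jobs-≤ ∘ f)
                                  0 (product rest * N)) ⟩
    16 * count freeDay? 0 (product rest * N)
      ≤⟨ free-days-bound (product rest * N) ⟩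
    49 + 3 * (product rest * N)
      ≡⟨ cong (_+_ 49) (sym (*-assoc 3 (product rest) N)) ⟩
    49 + 3 * product rest * N ∎
    where open ≤-Reasoning

  density-rest-≤ : All (λ a → 0 < a) rest → density rest ≤ℚ + 3 / 16
  density-rest-≤ pos = ℚ.toℚᵘ-cancel-≤ (ℚᵘ.≤-respˡ-≃ (ℚᵘ.≃-sym (density-fraction nz))
    (/-≤-/ _ _ 3 16 (subst (_≤ 3 * product rest) (*-comm 16 (sum (cofactors rest)))
                           cofactor-sum-bound)))
    where
    nz = All.map >-nonZero pos
    instance
      nzP : NonZero (product rest)
      nzP = product≢0 nz

lemma5p2 : (rest : List ℕ) →
    All (λ a → 0 < a) rest →
    Linked _≤_ (3 ∷ 6 ∷ 6 ∷ 8 ∷ rest) →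
    (+ 1 / 1) -ℚ (+ 1 / 96) <ℚ density (3 ∷ 6 ∷ 6 ∷ 8 ∷ rest) →
    ¬ Schedulable (3 ∷ 6 ∷ 6 ∷ 8 ∷ rest)
lemma5p2 rest pos _ dense (f , valid) = ℚ.<-irrefl refl (ℚ.<-≤-trans dense (begin
  density (3 ∷ 6 ∷ 6 ∷ 8 ∷ rest)
    ≤⟨ ℚ.+-monoʳ-≤ (recip 3) (ℚ.+-monoʳ-≤ (recip 6) (ℚ.+-monoʳ-≤ (recip 6)
         (ℚ.+-monoʳ-≤ (recip 8) (density-rest-≤ rest f valid pos)))) ⟩
  recip 3 +ℚ (recip 6 +ℚ (recip 6 +ℚ (recip 8 +ℚ + 3 / 16)))
    ≤⟨ from-yes (recip 3 +ℚ (recip 6 +ℚ (recip 6 +ℚ (recip 8 +ℚ + 3 / 16)))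
                   ℚ.≤? (+ 1 / 1) -ℚ (+ 1 / 96)) ⟩
  (+ 1 / 1) -ℚ (+ 1 / 96) ∎))
  where open ℚ.≤-Reasoning
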